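{- Let $m$ be a positive integer, $k\ge 2$ and $n\ge k-1$. Then the polynomials \[ (x_1\cdots x_n)^m(x_1^{l_1}\cdots x_n^{l_n})^{m+1}(x_1^d+\cdots+x_n^d), \] where $d,l_1,\ldots,l_n$ range over all non-negative integers with $d+(m+1)(l_1+\cdots+l_n)=(m+1)(k-1)-1$, form a basis of $W_{m,k}$ (in particular, they are linearly independent over $\mathbb{R}$).
   Context: $W_{m,k}\subseteq\mathbb{R}[x_1,\ldots,x_n]$ is defined as the real linear span of all polynomials $(x_1\cdots x_n)^m(x_1^{l_1}\cdots x_n^{l_n})^{m+1}(x_1^d+\cdots+x_n^d)$ with non-negative integers $d,l_1,\ldots,l_n$ satisfying $d+(m+1)(l_1+\cdots+l_n)=(m+1)(k-1)-1$.
   Formalization: The coefficient field is ℚ in place of ℝ: the polynomials have rational coefficients and linear independence is asserted for rational scalars only. -}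

module Defs where

open import Data.Nat using (ℕ; _+_; _*_; _∸_; suc)
open import Data.Nat.Properties using () renaming (_≟_ to _≟ℕ_)
open import Data.Rational using (ℚ; 0ℚ; 1ℚ) renaming (_+_ to _+ℚ_; _*_ to _*ℚ_)
open import Data.Fin using (Fin) renaming (_≟_ to _≟F_)
open import Data.Vec using (Vec; replicate; tabulate; zipWith) renaming (map to vmap; sum to vsum)
open import Data.Vec.Properties using (≡-dec)
open import Data.List using (List; []; _∷_; map; allFin; concatMap)
open import Data.Product using (_×_; _,_; proj₁; proj₂)
open import Relation.Nullary using (yes; no)
open import Relation.Binary.PropositionalEquality using (_≡_)

Monomial : ℕ → Set
Monomial n = Vec ℕ n

-- A polynomial in ℚ[x_1..x_n], given as a finite formal sum of terms c · x^e
-- (terms with equal exponents may repeat; they are added up by coeff).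
Poly : ℕ → Set
Poly n = List (ℚ × Monomial n)

coeff : ∀ {n} → Poly n → Monomial n → ℚ
coeff [] e = 0ℚ
coeff ((c , e') ∷ p) e with ≡-dec _≟ℕ_ e' e
... | yes _ = c +ℚ coeff p e
... | no  _ = coeff p e

IsZero : ∀ {n} → Poly n → Set
IsZero {n} p = (e : Monomial n) → coeff p e ≡ 0ℚ

scale : ∀ {n} → ℚ → Poly n → Poly n
scale c p = map (λ t → (c *ℚ proj₁ t , proj₂ t)) p

mulMono : ∀ {n} → Monomial n → Poly n → Poly n
mulMono e p = map (λ t → (proj₁ t , zipWith _+_ e (proj₂ t))) p

xPow : ∀ {n} → Fin n → ℕ → Monomial n
xPow i d = tabulate (λ j → sel j)
  where
  sel : _ → ℕ
  sel j with i ≟F j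
  ... | yes _ = d
  ... | no  _ = 0

powerSum : (n d : ℕ) → Poly n
powerSum n d = map (λ i → (1ℚ , xPow i d)) (allFin n)

gen : ∀ {n} → (m d : ℕ) → Vec ℕ n → Poly n
gen {n} m d l = mulMono (replicate n m) (mulMono (vmap (λ li → suc m * li) l) (powerSum n d))

Admissible : ∀ {n} → (m k : ℕ) → ℕ × Vec ℕ n → Set
Admissible m k (d , l) = d + suc m * vsum l ≡ suc m * (k ∸ 1) ∸ 1

linComb : ∀ {n} → ℕ → List (ℚ × (ℕ × Vec ℕ n)) → Poly n
linComb m cs = concatMap (λ t → scale (proj₁ t) (gen m (proj₁ (proj₂ t)) (proj₂ (proj₂ t)))) cs

-- For an admissible index (d , l), d ≡ -1 mod m+1, so (m+1) ∤ d, and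
-- vsum l < k - 1 ≤ n, so some entry l_i is 0. The monomial x^(m + (m+1) l) x_i^d occurs exactly
-- once in gen m d l and in no other gen m d' l' with d' ≥ d: matching it with the term of
-- gen m d' l' at a position i' ≠ i would give (m+1) ∣ d, and at i' = i it forces d' = d, l' = l.
-- Terms with d' < d already have coefficient 0, so the coefficient of this monomial in the
-- vanishing combination is the coefficient of (d , l) itself.
module Submission where

open import Defs
open import Data.Nat using (ℕ; zero; suc; _+_; _*_; _∸_; _≤_; _<_; s≤s; _<?_)
open import Data.Nat.Properties
  using (_≟_; +-comm; +-identityʳ; *-comm; *-zeroʳ; +-cancelˡ-≡; +-cancelʳ-≡; *-cancelˡ-≡; *-cancelˡ-<;
         m≤n+m; ≤-refl; ≤-trans; ≤-antisym; ≮⇒≥; <⇒≢; suc-injective)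
open import Data.Nat.Divisibility using (_∣_; _∤_; divides; m∣m*n; ∣m∣n⇒∣m+n; ∣m+n∣m⇒∣n; ∣1⇒≡1)
open import Data.Nat.Induction using (<-rec)
open import Data.Rational using (ℚ; 0ℚ; 1ℚ) renaming (_+_ to _+ℚ_; _*_ to _*ℚ_)
import Data.Rational.Properties as ℚ
open import Data.Fin using (Fin) renaming (zero to fzero; suc to fsuc; _≟_ to _≟F_)
open import Data.Vec using (Vec; _∷_; lookup; replicate; zipWith) renaming (map to vmap; sum to vsum)
open import Data.Vec.Properties using (≡-dec; lookup∘tabulate; lookup-zipWith; lookup-replicate; lookup-map)
open import Data.Vec.Relation.Binary.Pointwise.Extensional using (ext; Pointwise-≡⇒≡)
open import Data.List using (List; []; _∷_; [_]; _++_; map; foldr; concatMap; allFin)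
open import Data.List.Properties using (map-∘; map-id; map-cong)
open import Data.List.Relation.Unary.All as All using (All; []; _∷_)
open import Data.List.Relation.Unary.All.Properties using (map⁻)
open import Data.List.Relation.Unary.Any using (here; there)
open import Data.List.Membership.Propositional using (_∈_)
open import Data.List.Membership.Propositional.Properties using (∈-map⁺; ∈-allFin)
open import Data.List.Relation.Unary.Unique.Propositional using (Unique)
open import Data.List.Relation.Unary.Unique.Propositional.Properties using (allFin⁺)
open import Data.List.Relation.Unary.AllPairs using (_∷_)
open import Data.Product using (_×_; _,_; proj₁; proj₂; ∃-syntax)
open import Data.Empty using (⊥-elim)
open import Function using (id; _∘_; _∋_)
open import Relation.Nullary using (yes; no)
open import Relation.Binary.PropositionalEquality using (_≡_; _≢_; refl; sym; trans; cong; cong₂; subst; module ≡-Reasoning)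

sumℚ : List ℚ → ℚ
sumℚ = foldr _+ℚ_ 0ℚ

sumℚ-map-vanishing : ∀ {a} {A : Set a} (f : A → ℚ) {xs : List A} →
  All (λ x → f x ≡ 0ℚ) xs → sumℚ (map f xs) ≡ 0ℚ
sumℚ-map-vanishing f []              = refl
sumℚ-map-vanishing f (fx≡0 ∷ fxs≡0) = trans (cong₂ _+ℚ_ fx≡0 (sumℚ-map-vanishing f fxs≡0)) (ℚ.+-identityˡ 0ℚ)

sumℚ-map-singleSupport : ∀ {a b} {A : Set a} {K : Set b} (key : A → K) (f : A → ℚ) {xs : List A} {x₀ : A} →
  Unique (map key xs) → x₀ ∈ xs → All (λ x → key x ≢ key x₀ → f x ≡ 0ℚ) xs → sumℚ (map f xs) ≡ f x₀
sumℚ-map-singleSupport key f {x ∷ xs} (fresh ∷ _) (here refl) (_ ∷ others) =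
  trans (cong (f x +ℚ_) (sumℚ-map-vanishing f
           (All.zipWith (λ (x≢ , vanish) → vanish (x≢ ∘ sym)) (map⁻ fresh , others))))
        (ℚ.+-identityʳ (f x))
sumℚ-map-singleSupport key f {x ∷ xs} (fresh ∷ unique) (there x₀∈xs) (vanish ∷ others) =
  trans (cong₂ _+ℚ_ (vanish (All.lookup fresh (∈-map⁺ key x₀∈xs)))
                    (sumℚ-map-singleSupport key f unique x₀∈xs others))
        (ℚ.+-identityˡ (f _))

module _ {n : ℕ} where

  coeff-++ : (p q : Poly n) (e : Monomial n) → coeff (p ++ q) e ≡ coeff p e +ℚ coeff q e
  coeff-++ []              q e = sym (ℚ.+-identityˡ _)
  coeff-++ ((c , e') ∷ p) q e with ≡-dec _≟_ e' e
  ... | yes _ = trans (cong (c +ℚ_) (coeff-++ p q e)) (sym (ℚ.+-assoc c _ _))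
  ... | no  _ = coeff-++ p q e

  coeff-scale : (c : ℚ) (p : Poly n) (e : Monomial n) → coeff (scale c p) e ≡ c *ℚ coeff p e
  coeff-scale c []               e = sym (ℚ.*-zeroʳ c)
  coeff-scale c ((c' , e') ∷ p) e with ≡-dec _≟_ e' e
  ... | yes _ = trans (cong (c *ℚ c' +ℚ_) (coeff-scale c p e)) (sym (ℚ.*-distribˡ-+ c c' _))
  ... | no  _ = coeff-scale c p e

  coeff-concatMap : ∀ {a} {A : Set a} (f : A → Poly n) (xs : List A) (e : Monomial n) →
    coeff (concatMap f xs) e ≡ sumℚ (map (λ x → coeff (f x) e) xs)
  coeff-concatMap f []       e = refl
  coeff-concatMap f (x ∷ xs) e =
    trans (coeff-++ (f x) (concatMap f xs) e) (cong (coeff (f x) e +ℚ_) (coeff-concatMap f xs e))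

  coeff-map : ∀ {a} {A : Set a} (f : A → ℚ × Monomial n) (xs : List A) (e : Monomial n) →
    coeff (map f xs) e ≡ sumℚ (map (λ x → coeff [ f x ] e) xs)
  coeff-map f []       e = refl
  coeff-map f (x ∷ xs) e = trans (coeff-++ [ f x ] (map f xs) e) (cong (coeff [ f x ] e +ℚ_) (coeff-map f xs e))

  coeff-[]-self : (c : ℚ) (e : Monomial n) → coeff [ (c , e) ] e ≡ c
  coeff-[]-self c e with ≡-dec _≟_ e e
  ... | yes _   = ℚ.+-identityʳ c
  ... | no  e≢e = ⊥-elim (e≢e refl)

  coeff-[]-≢ : (c : ℚ) {e e' : Monomial n} → e ≢ e' → coeff [ (c , e) ] e' ≡ 0ℚ
  coeff-[]-≢ c {e} {e'} e≢e' with ≡-dec _≟_ e e'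
  ... | yes e≡e' = ⊥-elim (e≢e' e≡e')
  ... | no  _    = refl

  coeff-linComb : (m : ℕ) (cs : List (ℚ × (ℕ × Vec ℕ n))) (e : Monomial n) →
    coeff (linComb m cs) e ≡ sumℚ (map (λ t → proj₁ t *ℚ coeff (gen m (proj₁ (proj₂ t)) (proj₂ (proj₂ t))) e) cs)
  coeff-linComb m cs e =
    trans (coeff-concatMap _ cs e) (cong sumℚ (map-cong (λ (c , d , l) → coeff-scale c (gen m d l) e) cs))

  mono : (m d : ℕ) → Vec ℕ n → Fin n → Monomial n
  mono m d l i = zipWith _+_ (replicate n m) (zipWith _+_ (vmap (suc m *_) l) (xPow i d))

  gen≡map-mono : (m d : ℕ) (l : Vec ℕ n) → gen m d l ≡ map (λ i → (1ℚ , mono m d l i)) (allFin n)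
  gen≡map-mono m d l = trans (cong (mulMono _) (sym (map-∘ (allFin n)))) (sym (map-∘ (allFin n)))

  coeff-gen : (m d : ℕ) (l : Vec ℕ n) (e : Monomial n) →
    coeff (gen m d l) e ≡ sumℚ (map (λ i → coeff [ (1ℚ , mono m d l i) ] e) (allFin n))
  coeff-gen m d l e = trans (cong (λ p → coeff p e) (gen≡map-mono m d l)) (coeff-map _ (allFin n) e)

  -- The ascriptions make the with-abstraction over i ≟F j reach the selector inside xPow.
  lookup-xPow-≡ : (i : Fin n) (d : ℕ) → lookup (xPow i d) i ≡ d
  lookup-xPow-≡ i d with i ≟F i | (lookup (xPow i d) i ≡ _ ∋ lookup∘tabulate _ i)
  ... | yes _   | lookup≡d = lookup≡d
  ... | no  i≢i | _        = ⊥-elim (i≢i refl)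

  lookup-xPow-≢ : {i j : Fin n} (d : ℕ) → i ≢ j → lookup (xPow i d) j ≡ 0
  lookup-xPow-≢ {i} {j} d i≢j with i ≟F j | (lookup (xPow i d) j ≡ _ ∋ lookup∘tabulate _ j)
  ... | yes i≡j | _        = ⊥-elim (i≢j i≡j)
  ... | no  _   | lookup≡0 = lookup≡0

  lookup-mono : (m d : ℕ) (l : Vec ℕ n) (i j : Fin n) →
    lookup (mono m d l i) j ≡ m + (suc m * lookup l j + lookup (xPow i d) j)
  lookup-mono m d l i j = begin
    lookup (mono m d l i) j
      ≡⟨ lookup-zipWith _+_ j (replicate n m) _ ⟩
    lookup (replicate n m) j + lookup (zipWith _+_ (vmap (suc m *_) l) (xPow i d)) j
      ≡⟨ cong₂ _+_ (lookup-replicate j m) (lookup-zipWith _+_ j (vmap (suc m *_) l) (xPow i d)) ⟩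
    m + (lookup (vmap (suc m *_) l) j + lookup (xPow i d) j)
      ≡⟨ cong (λ x → m + (x + lookup (xPow i d) j)) (lookup-map j (suc m *_) l) ⟩
    m + (suc m * lookup l j + lookup (xPow i d) j) ∎
    where open ≡-Reasoning

  mono-coordinates : ∀ {m d d' : ℕ} {l l' : Vec ℕ n} {i i' : Fin n} → mono m d' l' i' ≡ mono m d l i →
    ∀ j → suc m * lookup l' j + lookup (xPow i' d') j ≡ suc m * lookup l j + lookup (xPow i d) j
  mono-coordinates {m} {d} {d'} {l} {l'} {i} {i'} eq j = +-cancelˡ-≡ m _ _ (begin
    m + (suc m * lookup l' j + lookup (xPow i' d') j) ≡⟨ sym (lookup-mono m d' l' i' j) ⟩
    lookup (mono m d' l' i') j                       ≡⟨ cong (λ v → lookup v j) eq ⟩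
    lookup (mono m d l i) j                          ≡⟨ lookup-mono m d l i j ⟩
    m + (suc m * lookup l j + lookup (xPow i d) j)   ∎)
    where open ≡-Reasoning

  mono-pivot : ∀ (m d : ℕ) {l : Vec ℕ n} {i : Fin n} → lookup l i ≡ 0 →
    suc m * lookup l i + lookup (xPow i d) i ≡ d
  mono-pivot m d {l} {i} lᵢ≡0 =
    cong₂ _+_ (trans (cong (suc m *_) lᵢ≡0) (*-zeroʳ (suc m))) (lookup-xPow-≡ i d)

  coordinates-injective : ∀ {m d d' : ℕ} {l l' : Vec ℕ n} {i i' : Fin n} → suc m ∤ d → lookup l i ≡ 0 → d ≤ d' →
    (∀ j → suc m * lookup l' j + lookup (xPow i' d') j ≡ suc m * lookup l j + lookup (xPow i d) j) →
    i' ≡ i × d' ≡ d × l' ≡ l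
  coordinates-injective {m} {d} {d'} {l} {l'} {i} {i'} m+1∤d lᵢ≡0 d≤d' coordinate with i' ≟F i
  ... | no i'≢i = ⊥-elim (m+1∤d (divides (lookup l' i) (begin
    d                                           ≡⟨ sym (mono-pivot m d {l} lᵢ≡0) ⟩
    suc m * lookup l i + lookup (xPow i d) i    ≡⟨ sym (coordinate i) ⟩
    suc m * lookup l' i + lookup (xPow i' d') i ≡⟨ cong (suc m * lookup l' i +_) (lookup-xPow-≢ d' i'≢i) ⟩
    suc m * lookup l' i + 0                     ≡⟨ +-identityʳ _ ⟩
    suc m * lookup l' i                         ≡⟨ *-comm (suc m) _ ⟩
    lookup l' i * suc m                         ∎)))
    where open ≡-Reasoning
  ... | yes refl = refl , d'≡d , Pointwise-≡⇒≡ (ext l'ⱼ≡lⱼ)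
    where
    d'≤d : d' ≤ d
    d'≤d = subst (d' ≤_) (trans (cong (suc m * lookup l' i +_) (sym (lookup-xPow-≡ i d')))
                                (trans (coordinate i) (mono-pivot m d {l} lᵢ≡0)))
                         (m≤n+m d' _)
    d'≡d : d' ≡ d
    d'≡d = ≤-antisym d'≤d d≤d'
    l'ⱼ≡lⱼ : ∀ j → lookup l' j ≡ lookup l j
    l'ⱼ≡lⱼ j = *-cancelˡ-≡ _ _ (suc m) (+-cancelʳ-≡ (lookup (xPow i d) j) _ _
      (trans (cong (λ δ → suc m * lookup l' j + lookup (xPow i δ) j) (sym d'≡d)) (coordinate j)))

  mono-injective : ∀ {m d d' : ℕ} {l l' : Vec ℕ n} {i i' : Fin n} → suc m ∤ d → lookup l i ≡ 0 → d ≤ d' →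
    mono m d' l' i' ≡ mono m d l i → i' ≡ i × d' ≡ d × l' ≡ l
  mono-injective {m} {d} {d'} {l} {l'} {i} {i'} m+1∤d lᵢ≡0 d≤d' eq =
    coordinates-injective m+1∤d lᵢ≡0 d≤d' (mono-coordinates {m} {d} {d'} {l} {l'} {i} {i'} eq)

  coeff-gen-pivot : ∀ {m d : ℕ} {l : Vec ℕ n} {i : Fin n} → suc m ∤ d → lookup l i ≡ 0 →
    coeff (gen m d l) (mono m d l i) ≡ 1ℚ
  coeff-gen-pivot {m} {d} {l} {i} m+1∤d lᵢ≡0 = begin
    coeff (gen m d l) (mono m d l i)
      ≡⟨ coeff-gen m d l (mono m d l i) ⟩
    sumℚ (map (λ j → coeff [ (1ℚ , mono m d l j) ] (mono m d l i)) (allFin n))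
      ≡⟨ sumℚ-map-singleSupport id _ (subst Unique (sym (map-id (allFin n))) (allFin⁺ n)) (∈-allFin i)
           (All.tabulate (λ _ j≢i → coeff-[]-≢ 1ℚ (j≢i ∘ proj₁ ∘ mono-injective m+1∤d lᵢ≡0 ≤-refl))) ⟩
    coeff [ (1ℚ , mono m d l i) ] (mono m d l i)
      ≡⟨ coeff-[]-self 1ℚ (mono m d l i) ⟩
    1ℚ ∎
    where open ≡-Reasoning

  coeff-gen-above-pivot : ∀ {m d d' : ℕ} {l l' : Vec ℕ n} {i : Fin n} → suc m ∤ d → lookup l i ≡ 0 → d ≤ d' →
    (d' , l') ≢ (d , l) → coeff (gen m d' l') (mono m d l i) ≡ 0ℚ
  coeff-gen-above-pivot {m} {d} {d'} {l} {l'} {i} m+1∤d lᵢ≡0 d≤d' distinct =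
    trans (coeff-gen m d' l' (mono m d l i)) (sumℚ-map-vanishing _ {allFin n} (All.tabulate (λ {j} _ →
      coeff-[]-≢ 1ℚ {mono m d' l' j} (λ eq →
        let (_ , d'≡d , l'≡l) = mono-injective m+1∤d lᵢ≡0 d≤d' eq in distinct (cong₂ _,_ d'≡d l'≡l)))))

sum<length⇒∃lookup≡0 : ∀ {n} (l : Vec ℕ n) → vsum l < n → ∃[ i ] lookup l i ≡ 0
sum<length⇒∃lookup≡0 (zero  ∷ l) _         = fzero , refl
sum<length⇒∃lookup≡0 (suc x ∷ l) (s≤s sum<n) =
  let (i , lᵢ≡0) = sum<length⇒∃lookup≡0 l (≤-trans (s≤s (m≤n+m (vsum l) x)) sum<n) in fsuc i , lᵢ≡0

-- The truncated subtraction is harmless: suc (suc m * suc K ∸ 1) reduces to suc m * suc K.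
d+qs≡qK∸1⇒q∤d : ∀ m K d s → 1 ≤ m → d + suc m * s ≡ suc m * suc K ∸ 1 → suc m ∤ d
d+qs≡qK∸1⇒q∤d m K d s 1≤m eq q∣d = <⇒≢ 1≤m (sym (suc-injective (∣1⇒≡1 q∣1)))
  where
  q∣d+qs+1 : suc m ∣ d + suc m * s + 1
  q∣d+qs+1 = subst (suc m ∣_) (trans (cong suc (sym eq)) (+-comm 1 _)) (m∣m*n (suc K))
  q∣1 : suc m ∣ 1
  q∣1 = ∣m+n∣m⇒∣n q∣d+qs+1 (∣m∣n⇒∣m+n q∣d (m∣m*n s))

d+qs≡qK∸1⇒s<K : ∀ m K d s → d + suc m * s ≡ suc m * suc K ∸ 1 → s < suc K
d+qs≡qK∸1⇒s<K m K d s eq = *-cancelˡ-< (suc m) s (suc K) (s≤s (subst (suc m * s ≤_) eq (m≤n+m _ d)))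

-- At a zero entry i of l, the monomial mono m d l i singles out gen m d l among all gen m d' l'
-- with d ≤ d'.
HasPivot : ∀ {n} → ℕ → ℕ × Vec ℕ n → Set
HasPivot m (d , l) = suc m ∤ d × ∃[ i ] lookup l i ≡ 0

admissible⇒hasPivot : ∀ {m k' n : ℕ} → 1 ≤ m → suc k' ≤ n →
  ∀ {x : ℕ × Vec ℕ n} → Admissible m (suc (suc k')) x → HasPivot m x
admissible⇒hasPivot {m} {k'} 1≤m k-1≤n {d , l} adm =
  d+qs≡qK∸1⇒q∤d m k' d (vsum l) 1≤m adm ,
  sum<length⇒∃lookup≡0 l (≤-trans (d+qs≡qK∸1⇒s<K m k' d (vsum l) adm) k-1≤n)

gen-independent : ∀ {n} (m : ℕ) (cs : List (ℚ × (ℕ × Vec ℕ n))) → All (HasPivot m ∘ proj₂) cs →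
  Unique (map proj₂ cs) → IsZero (linComb m cs) → All (λ t → proj₁ t ≡ 0ℚ) cs
gen-independent {n} m cs pivots unique vanishes = All.tabulate (λ {t} t∈cs → <-rec Vanishes step (proj₁ (proj₂ t)) t∈cs)
  where
  Vanishes : ℕ → Set
  Vanishes d = ∀ {c l} → (c , d , l) ∈ cs → c ≡ 0ℚ

  summand : Monomial n → ℚ × (ℕ × Vec ℕ n) → ℚ
  summand e (c , d , l) = c *ℚ coeff (gen m d l) e

  step : ∀ d₀ → (∀ {d} → d < d₀ → Vanishes d) → Vanishes d₀
  step d₀ ih {c₀} {l₀} t₀∈cs = vanishes-at-pivot (All.lookup pivots t₀∈cs)
    where
    vanishes-at-pivot : HasPivot m (d₀ , l₀) → c₀ ≡ 0ℚ
    vanishes-at-pivot (m+1∤d₀ , i , l₀ᵢ≡0) = begin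
      c₀                             ≡⟨ sym (ℚ.*-identityʳ c₀) ⟩
      c₀ *ℚ 1ℚ                       ≡⟨ cong (c₀ *ℚ_) (sym (coeff-gen-pivot {m = m} {d₀} {l₀} {i} m+1∤d₀ l₀ᵢ≡0)) ⟩
      summand pivot (c₀ , d₀ , l₀)
        ≡⟨ sym (sumℚ-map-singleSupport proj₂ (summand pivot) unique t₀∈cs (All.tabulate other-vanishes)) ⟩
      sumℚ (map (summand pivot) cs)  ≡⟨ sym (coeff-linComb m cs pivot) ⟩
      coeff (linComb m cs) pivot     ≡⟨ vanishes pivot ⟩
      0ℚ                             ∎
      where
      open ≡-Reasoning
      pivot : Monomial n
      pivot = mono m d₀ l₀ i
      other-vanishes : ∀ {t} → t ∈ cs → proj₂ t ≢ (d₀ , l₀) → summand pivot t ≡ 0ℚ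
      other-vanishes {c , d , l} t∈cs distinct with d <? d₀
      ... | yes d<d₀ = trans (cong (_*ℚ coeff (gen m d l) pivot) (ih d<d₀ t∈cs))
                             (ℚ.*-zeroˡ (coeff (gen m d l) pivot))
      ... | no  d≮d₀ = trans (cong (c *ℚ_) (coeff-gen-above-pivot m+1∤d₀ l₀ᵢ≡0 (≮⇒≥ d≮d₀) distinct))
                             (ℚ.*-zeroʳ c)

lemma4p3 : (m k n : ℕ) → 1 ≤ m → 2 ≤ k → k ∸ 1 ≤ n →
    (cs : List (ℚ × (ℕ × Vec ℕ n))) →
    All (λ t → Admissible m k (proj₂ t)) cs →
    Unique (map proj₂ cs) →
    IsZero (linComb m cs) →
    All (λ t → proj₁ t ≡ 0ℚ) cs
lemma4p3 m (suc zero) n _ (s≤s ()) _ _ _ _ _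
lemma4p3 m (suc (suc k')) n 1≤m _ k-1≤n cs admissible unique vanishes =
  gen-independent m cs (All.map (λ {t} → admissible⇒hasPivot 1≤m k-1≤n {proj₂ t}) admissible) unique vanishes
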